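{- Let $\operatorname{per}_3=\sum_{\sigma\in\Sigma_3}e_{\sigma(1)}\otimes e_{\sigma(2)}\otimes e_{\sigma(3)}\in\mathbb{Z}^3\otimes\mathbb{Z}^3\otimes\mathbb{Z}^3$. Then for $p$ equal to $0$ or a prime, $$\operatorname{trk}_p(\operatorname{per}_3)=\begin{cases}5&\text{if }p=2,\\4&\text{otherwise.}\end{cases}$$
   Context: $e_1,e_2,e_3$ is the standard basis of $\mathbb{Z}^3$. For a tensor $T\in\mathbb{Z}^{n_1}\otimes\cdots\otimes\mathbb{Z}^{n_m}$ and a field $K$, $T$ is viewed as $T\otimes_{\mathbb{Z}}1\in K^{n_1}\otimes\cdots\otimes K^{n_m}$, and $\operatorname{trk}_p(T)$ denotes its tensor rank (least number of simple tensors $v_1\otimes\cdots\otimes v_m$ summing to it) over an algebraically closed field of characteristic $p$. -}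

module Defs where

open import Level using (Level; _⊔_)
open import Algebra.Bundles using (CommutativeRing)
open import Data.Nat using (ℕ; _≤_)
open import Data.Nat.Divisibility using (_∣_)
open import Data.Integer using (ℤ; +_; -[1+_])
import Data.Integer as ℤ
open import Data.Fin using (Fin; _≟_)
open import Data.Vec using (Vec; []; _∷_)
open import Data.List using (List; []; _∷_)
open import Data.Product using (Σ; ∃; _×_; _,_)
open import Relation.Nullary using (¬_; yes; no)
open import Function.Bundles using (_⇔_)

record Field (c ℓ : Level) : Set (Level.suc (c ⊔ ℓ)) where
  field
    commutativeRing : CommutativeRing c ℓ
  open CommutativeRing commutativeRing public
  field
    1≉0     : ¬ (1# ≈ 0#)
    inverse : ∀ x → ¬ (x ≈ 0#) → ∃ λ y → x * y ≈ 1#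

module _ {c ℓ} (K : Field c ℓ) where
  open Field K using (Carrier; _≈_; _+_; _*_; -_; 0#; 1#)

  -- evaluation of the monic polynomial x^n + a_{n-1} x^{n-1} + ... + a_0,
  -- coefficients given as (a_{n-1} ∷ ... ∷ a_0) via Horner's scheme
  evalMonic : ∀ {n} → Vec Carrier n → Carrier → Carrier
  evalMonic as x = go 1# as
    where
    go : ∀ {m} → Carrier → Vec Carrier m → Carrier
    go acc []       = acc
    go acc (a ∷ as) = go (acc * x + a) as

  AlgebraicallyClosed : Set (c ⊔ ℓ)
  AlgebraicallyClosed = ∀ (n : ℕ) (as : Vec Carrier (ℕ.suc n)) → ∃ λ x → evalMonic as x ≈ 0#

  natCast : ℕ → Carrier
  natCast ℕ.zero    = 0#
  natCast (ℕ.suc n) = 1# + natCast n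

  intCast : ℤ → Carrier
  intCast (+ n)      = natCast n
  intCast -[1+ n ]   = - natCast (ℕ.suc n)

  HasCharacteristic : ℕ → Set ℓ
  HasCharacteristic p = ∀ (n : ℕ) → (natCast n ≈ 0#) ⇔ (p ∣ n)

  Σ[_] : ∀ (r : ℕ) → (Fin r → Carrier) → Carrier
  Σ[ ℕ.zero  ] f = 0#
  Σ[ ℕ.suc r ] f = f Fin.zero + Σ[ r ] (λ l → f (Fin.suc l))

  Tensor3 : ℕ → ℕ → ℕ → Set c
  Tensor3 n₁ n₂ n₃ = Fin n₁ → Fin n₂ → Fin n₃ → Carrier

  SumOfSimple : ∀ {n₁ n₂ n₃} → Tensor3 n₁ n₂ n₃ → ℕ → Set (c ⊔ ℓ)
  SumOfSimple {n₁} {n₂} {n₃} T r =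
    Σ (Fin r → Fin n₁ → Carrier) λ u →
    Σ (Fin r → Fin n₂ → Carrier) λ v →
    Σ (Fin r → Fin n₃ → Carrier) λ w →
    ∀ i j k → T i j k ≈ Σ[ r ] (λ l → u l i * v l j * w l k)

  TensorRank : ∀ {n₁ n₂ n₃} → Tensor3 n₁ n₂ n₃ → ℕ → Set (c ⊔ ℓ)
  TensorRank T r = SumOfSimple T r × (∀ s → SumOfSimple T s → r ≤ s)

  castTensor : ∀ {n₁ n₂ n₃} → (Fin n₁ → Fin n₂ → Fin n₃ → ℤ) → Tensor3 n₁ n₂ n₃
  castTensor T i j k = intCast (T i j k)

δ : ∀ {n} → Fin n → Fin n → ℤ
δ a i with a ≟ i
... | yes _ = + 1
... | no  _ = + 0

-- the six permutations σ ∈ Σ₃, listed as (σ(1), σ(2), σ(3))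
perms3 : List (Fin 3 × Fin 3 × Fin 3)
perms3 =
    (f0 , f1 , f2) ∷ (f0 , f2 , f1) ∷ (f1 , f0 , f2)
  ∷ (f1 , f2 , f0) ∷ (f2 , f0 , f1) ∷ (f2 , f1 , f0) ∷ []
  where
  f0 f1 f2 : Fin 3
  f0 = Fin.zero
  f1 = Fin.suc Fin.zero
  f2 = Fin.suc (Fin.suc Fin.zero)

per3 : Fin 3 → Fin 3 → Fin 3 → ℤ
per3 i j k = go perms3
  where
  go : List (Fin 3 × Fin 3 × Fin 3) → ℤ
  go []                    = + 0
  go ((a , b , c) ∷ rest)  = δ a i ℤ.* δ b j ℤ.* δ c k ℤ.+ go rest

-- The lower bounds rest on the slices of per₃: contracting its first factor with x ∈ K³ gives
-- the symmetric matrix with zero diagonal and off-diagonal entries x₀, x₁, x₂, whose 2×2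
-- principal minors are −xₘ², so a slice of rank ≤ 1 forces x = 0.  In a decomposition
-- Σₗ uₗ ⊗ vₗ ⊗ wₗ the slice along any x orthogonal to all uₗ but one has rank ≤ 1.  With three
-- terms, taking x = uₗ × uₗ′ shows that the uₗ are pairwise parallel and then zero; with four
-- terms, two parallel first factors make a third one vanish, leaving three terms.  In
-- characteristic 2 the slice is also antisymmetric, namely the matrix of x × –; this makes u₃
-- orthogonal to every wₗ × wₗ′ with l, l′ < 3, so either w₀, w₁, w₂ are dependent and the
-- previous argument applies with the first and third factors exchanged, or u₃ = 0.  The upper
-- bounds are explicit integral decompositions.

module Submission where

open import Level using (Level; _⊔_)
open import Algebra.Bundles.Raw using (RawRing)
open import Algebra.Solver.Ring.AlmostCommutativeRing using (fromCommutativeRing; _-Raw-AlmostCommutative⟶_)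
open import Data.Empty using (⊥; ⊥-elim)
open import Data.Fin using (Fin; zero; suc; combine; punchIn)
open import Data.Fin.Patterns
open import Data.Fin.Permutation using (Permutation; _⟨$⟩ʳ_; transpose; _∘ₚ_)
open import Data.Fin.Properties using (punchInᵢ≢i; all?)
open import Data.Integer as ℤ using (ℤ; +_; -[1+_]; 0ℤ; 1ℤ; -1ℤ)
open import Data.Integer.Base using (+-*-rawRing)
import Data.Integer.Properties as ℤ
open import Algebra.Definitions.RawMonoid ℤ.+-0-rawMonoid using () renaming (sum to sumℤ)
open import Data.Maybe using (Maybe; just; nothing)
open import Data.Nat as ℕ using (ℕ; zero; suc; _≤_; _≤′_; ≤′-refl; ≤′-step; nonTrivial⇒n>1)
import Data.Nat.Properties as ℕ
open import Data.Nat.Divisibility using (_∣_; ∣-refl; ∣⇒≤; 0∣⇒≡0)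
open import Data.Nat.Primality using (Prime; prime⇒nonTrivial)
open import Data.Product using (_×_; _,_; proj₁; proj₂)
open import Data.Sum using (_⊎_; inj₁; inj₂)
open import Data.Vec as Vec using (Vec; []; _∷_)
open import Data.Vec.Functional using (removeAt)
open import Function.Bundles using (Equivalence)
open import Relation.Binary.PropositionalEquality using (_≡_; _≢_)
import Relation.Binary.PropositionalEquality as ≡
open import Relation.Nullary using (¬_; Dec; yes; no)
open import Relation.Nullary.Decidable using (True; toWitness; ¬¬-excluded-middle)
open import Relation.Nullary.Negation using (¬¬-map; negated-stable; contradiction)
open import Defs

private
  variable
    a b : Level
    A : Set a
    B : Set b

-- Equality in K is not decidable, so the case analyses of the lower bounds run in the
-- double-negation monad; each of them ends in ⊥.
_>>=_ : ¬ ¬ A → (A → ¬ ¬ B) → ¬ ¬ B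
m >>= f = negated-stable (¬¬-map f m)

pure : A → ¬ ¬ A
pure x ¬x = ¬x x

¬¬⊥⇒⊥ : ¬ ¬ ⊥ → ⊥
¬¬⊥⇒⊥ ¬¬⊥ = ¬¬⊥ λ ()

-- Stated for any raw ring so that it applies both to K and to the solver's polynomials:
-- identities between vectors of K³ are proved on symbolic vectors.
module Vector3 {c ℓ} (R : RawRing c ℓ) where
  open RawRing R

  dot : (Fin 3 → Carrier) → (Fin 3 → Carrier) → Carrier
  dot x y = x 0F * y 0F + (x 1F * y 1F + (x 2F * y 2F + 0#))

  cross : (Fin 3 → Carrier) → (Fin 3 → Carrier) → Fin 3 → Carrier
  cross x y 0F = x 1F * y 2F + - (x 2F * y 1F)
  cross x y 1F = x 2F * y 0F + - (x 0F * y 2F)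
  cross x y 2F = x 0F * y 1F + - (x 1F * y 0F)

  permanentSlice : (Fin 3 → Carrier) → Fin 3 → Fin 3 → Carrier
  permanentSlice x 0F 0F = 0#
  permanentSlice x 0F 1F = x 2F
  permanentSlice x 0F 2F = x 1F
  permanentSlice x 1F 0F = x 2F
  permanentSlice x 1F 1F = 0#
  permanentSlice x 1F 2F = x 0F
  permanentSlice x 2F 0F = x 1F
  permanentSlice x 2F 1F = x 0F
  permanentSlice x 2F 2F = 0#

by-evaluation : ∀ {n₁ n₂ n₃} (S T : Fin n₁ → Fin n₂ → Fin n₃ → ℤ) →
  True (all? λ i → all? λ j → all? λ k → S i j k ℤ.≟ T i j k) → ∀ i j k → S i j k ≡ T i j k
by-evaluation S T = toWitness

per3-symmetric₁₃ : ∀ i j k → per3 k j i ≡ per3 i j k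
per3-symmetric₁₃ = by-evaluation (λ i j k → per3 k j i) per3 _

rows : ∀ {r n} → Vec (Vec ℤ n) r → Fin r → Fin n → ℤ
rows t l i = Vec.lookup (Vec.lookup t l) i

-- Glynn's formula: 4 per₃ = Σ_δ (δ₀δ₁δ₂) δ ⊗ δ ⊗ δ over δ ∈ {1} × {±1}².
glynn glynn-signed : Fin 4 → Fin 3 → ℤ
glynn = rows
  ( (1ℤ ∷  1ℤ ∷  1ℤ ∷ [])
  ∷ (1ℤ ∷  1ℤ ∷ -1ℤ ∷ [])
  ∷ (1ℤ ∷ -1ℤ ∷  1ℤ ∷ [])
  ∷ (1ℤ ∷ -1ℤ ∷ -1ℤ ∷ [])
  ∷ [])
glynn-signed = rows
  ( ( 1ℤ ∷  1ℤ ∷  1ℤ ∷ [])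
  ∷ (-1ℤ ∷ -1ℤ ∷  1ℤ ∷ [])
  ∷ (-1ℤ ∷  1ℤ ∷ -1ℤ ∷ [])
  ∷ ( 1ℤ ∷ -1ℤ ∷ -1ℤ ∷ [])
  ∷ [])

glynn-formula : ∀ i j k → sumℤ (λ l → glynn l i ℤ.* glynn l j ℤ.* glynn-signed l k) ≡ + 4 ℤ.* per3 i j k
glynn-formula = by-evaluation _ (λ i j k → + 4 ℤ.* per3 i j k) _

-- Found by a computer search; being integral, it works in every characteristic.
five₁ five₂ five₃ : Fin 5 → Fin 3 → ℤ
five₁ = rows
  ( (0ℤ ∷ -1ℤ ∷  1ℤ ∷ [])
  ∷ (0ℤ ∷ -1ℤ ∷  0ℤ ∷ [])
  ∷ (0ℤ ∷  0ℤ ∷  1ℤ ∷ [])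
  ∷ (1ℤ ∷  0ℤ ∷  0ℤ ∷ [])
  ∷ (1ℤ ∷  1ℤ ∷ -1ℤ ∷ [])
  ∷ [])
five₂ = rows
  ( (1ℤ ∷ -1ℤ ∷  0ℤ ∷ [])
  ∷ (1ℤ ∷ -1ℤ ∷ -1ℤ ∷ [])
  ∷ (1ℤ ∷  0ℤ ∷  0ℤ ∷ [])
  ∷ (0ℤ ∷  0ℤ ∷  1ℤ ∷ [])
  ∷ (0ℤ ∷  1ℤ ∷  0ℤ ∷ [])
  ∷ [])
five₃ = rows
  ( (-1ℤ ∷ 0ℤ ∷ -1ℤ ∷ [])
  ∷ ( 1ℤ ∷ 0ℤ ∷  0ℤ ∷ [])
  ∷ ( 1ℤ ∷ 1ℤ ∷  1ℤ ∷ [])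
  ∷ ( 0ℤ ∷ 1ℤ ∷  0ℤ ∷ [])
  ∷ ( 0ℤ ∷ 0ℤ ∷  1ℤ ∷ [])
  ∷ [])

five-term-formula : ∀ i j k → sumℤ (λ l → five₁ l i ℤ.* five₂ l j ℤ.* five₃ l k) ≡ 1ℤ ℤ.* per3 i j k
five-term-formula = by-evaluation _ (λ i j k → 1ℤ ℤ.* per3 i j k) _

module PermanentTensor {c ℓ : Level} (K : Field c ℓ) where
  open Field K hiding (zero)
  open import Relation.Binary.Reasoning.Setoid setoid
  open import Algebra.Properties.Ring ring using (-‿involutive; -‿distribˡ-*; -‿distribʳ-*; -0#≈0#)
  open import Algebra.Properties.AbelianGroup +-abelianGroup using (xyx⁻¹≈y; ⁻¹-∙-comm)
  open import Algebra.Properties.Semiring.Mult semiring using (×-homo-+; ×1-homo-*) renaming (_×_ to _×′_)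

  ι : ℤ → Carrier
  ι = intCast K

  natCast≈×1# : ∀ n → natCast K n ≈ n ×′ 1#
  natCast≈×1# zero    = refl
  natCast≈×1# (suc n) = +-congˡ (natCast≈×1# n)

  natCast-+ : ∀ m n → natCast K (m ℕ.+ n) ≈ natCast K m + natCast K n
  natCast-+ m n = begin
    natCast K (m ℕ.+ n)        ≈⟨ natCast≈×1# (m ℕ.+ n) ⟩
    (m ℕ.+ n) ×′ 1#            ≈⟨ ×-homo-+ 1# m n ⟩
    m ×′ 1# + n ×′ 1#          ≈⟨ +-cong (natCast≈×1# m) (natCast≈×1# n) ⟨
    natCast K m + natCast K n  ∎

  natCast-* : ∀ m n → natCast K (m ℕ.* n) ≈ natCast K m * natCast K n
  natCast-* m n = begin
    natCast K (m ℕ.* n)        ≈⟨ natCast≈×1# (m ℕ.* n) ⟩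
    (m ℕ.* n) ×′ 1#            ≈⟨ ×1-homo-* m n ⟩
    m ×′ 1# * n ×′ 1#          ≈⟨ *-cong (natCast≈×1# m) (natCast≈×1# n) ⟨
    natCast K m * natCast K n  ∎

  intCast-neg : ∀ x → ι (ℤ.- x) ≈ - ι x
  intCast-neg (+ zero)  = sym -0#≈0#
  intCast-neg (+ suc n) = refl
  intCast-neg -[1+ n ]  = sym (-‿involutive _)

  intCast-⊖ : ∀ m n → ι (m ℤ.⊖ n) ≈ natCast K m + - natCast K n
  intCast-⊖ m       zero    = sym (trans (+-congˡ -0#≈0#) (+-identityʳ _))
  intCast-⊖ zero    (suc n) = sym (+-identityˡ _)
  intCast-⊖ (suc m) (suc n) = begin
    ι (suc m ℤ.⊖ suc n)                  ≡⟨ ≡.cong ι (ℤ.[1+m]⊖[1+n]≡m⊖n m n) ⟩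
    ι (m ℤ.⊖ n)                          ≈⟨ intCast-⊖ m n ⟩
    natCast K m + - natCast K n          ≈⟨ +-congʳ (xyx⁻¹≈y 1# _) ⟨
    (1# + natCast K m) + - 1# + - natCast K n  ≈⟨ +-assoc _ _ _ ⟩
    (1# + natCast K m) + (- 1# + - natCast K n)  ≈⟨ +-congˡ (⁻¹-∙-comm 1# _) ⟩
    (1# + natCast K m) + - (1# + natCast K n)  ∎

  intCast-+ : ∀ x y → ι (x ℤ.+ y) ≈ ι x + ι y
  intCast-+ (+ m)    (+ n)    = natCast-+ m n
  intCast-+ (+ m)    -[1+ n ] = intCast-⊖ m (suc n)
  intCast-+ -[1+ m ] (+ n)    = trans (intCast-⊖ n (suc m)) (+-comm _ _)
  intCast-+ -[1+ m ] -[1+ n ] = begin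
    ι (ℤ.- (+ suc m) ℤ.+ ℤ.- (+ suc n))  ≡⟨ ≡.cong ι (ℤ.neg-distrib-+ (+ suc m) (+ suc n)) ⟨
    ι (ℤ.- (+ (suc m ℕ.+ suc n)))        ≈⟨ -‿cong (natCast-+ (suc m) (suc n)) ⟩
    - (natCast K (suc m) + natCast K (suc n))  ≈⟨ ⁻¹-∙-comm _ _ ⟨
    ι -[1+ m ] + ι -[1+ n ]              ∎

  intCast-*-+ : ∀ m y → ι (+ m ℤ.* y) ≈ ι (+ m) * ι y
  intCast-*-+ m (+ n)    = trans (reflexive (≡.cong ι (≡.sym (ℤ.pos-* m n)))) (natCast-* m n)
  intCast-*-+ m -[1+ n ] = begin
    ι (+ m ℤ.* ℤ.- (+ suc n))  ≡⟨ ≡.cong ι (ℤ.neg-distribʳ-* (+ m) (+ suc n)) ⟨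
    ι (ℤ.- (+ m ℤ.* + suc n))  ≈⟨ intCast-neg (+ m ℤ.* + suc n) ⟩
    - ι (+ m ℤ.* + suc n)      ≈⟨ -‿cong (intCast-*-+ m (+ suc n)) ⟩
    - (ι (+ m) * ι (+ suc n))  ≈⟨ -‿distribʳ-* _ _ ⟩
    ι (+ m) * ι -[1+ n ]       ∎

  intCast-* : ∀ x y → ι (x ℤ.* y) ≈ ι x * ι y
  intCast-* (+ m)    y = intCast-*-+ m y
  intCast-* -[1+ m ] y = begin
    ι (ℤ.- (+ suc m) ℤ.* y)  ≡⟨ ≡.cong ι (ℤ.neg-distribˡ-* (+ suc m) y) ⟨
    ι (ℤ.- (+ suc m ℤ.* y))  ≈⟨ intCast-neg (+ suc m ℤ.* y) ⟩
    - ι (+ suc m ℤ.* y)      ≈⟨ -‿cong (intCast-*-+ (suc m) y) ⟩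
    - (ι (+ suc m) * ι y)    ≈⟨ -‿distribˡ-* _ _ ⟩
    ι -[1+ m ] * ι y         ∎

  intCast-morphism : +-*-rawRing -Raw-AlmostCommutative⟶ fromCommutativeRing commutativeRing
  intCast-morphism = record
    { ⟦_⟧    = ι
    ; +-homo = intCast-+
    ; *-homo = intCast-*
    ; -‿homo = intCast-neg
    ; 0-homo = refl
    ; 1-homo = +-identityʳ 1#
    }

  intCast-≟ : ∀ x y → Maybe (ι x ≈ ι y)
  intCast-≟ x y with x ℤ.≟ y
  ... | yes ≡.refl = just refl
  ... | no _       = nothing

  open import Algebra.Solver.Ring +-*-rawRing (fromCommutativeRing commutativeRing) intCast-morphism intCast-≟

  x*y≈0⇒y≈0 : ∀ {x y} → ¬ x ≈ 0# → x * y ≈ 0# → y ≈ 0#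
  x*y≈0⇒y≈0 {x} {y} x≉0 xy≈0 with inverse x x≉0
  ... | x⁻¹ , xx⁻¹≈1 = begin
    y              ≈⟨ *-identityˡ y ⟨
    1# * y         ≈⟨ *-congʳ xx⁻¹≈1 ⟨
    x * x⁻¹ * y    ≈⟨ solve 3 (λ x x⁻¹ y → x :* x⁻¹ :* y := x⁻¹ :* (x :* y)) refl x x⁻¹ y ⟩
    x⁻¹ * (x * y)  ≈⟨ *-congˡ xy≈0 ⟩
    x⁻¹ * 0#       ≈⟨ zeroʳ x⁻¹ ⟩
    0#             ∎

  x≈0⇒x*y≈0 : ∀ {x y} → x ≈ 0# → x * y ≈ 0#
  x≈0⇒x*y≈0 x≈0 = trans (*-congʳ x≈0) (zeroˡ _)

  x≈0⇒y*x≈0 : ∀ {x y} → x ≈ 0# → y * x ≈ 0#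
  x≈0⇒y*x≈0 x≈0 = trans (*-congˡ x≈0) (zeroʳ _)

  x≈0⇒x*y*z≈0 : ∀ {x y z} → x ≈ 0# → x * y * z ≈ 0#
  x≈0⇒x*y*z≈0 x≈0 = x≈0⇒x*y≈0 (x≈0⇒x*y≈0 x≈0)

  commutator-zero : ∀ {x y} → x * y + - (y * x) ≈ 0#
  commutator-zero {x} {y} = trans (+-congˡ (-‿cong (*-comm y x))) (-‿inverseʳ (x * y))

  x*x≈0⇒x≈0 : ∀ {x} → x * x ≈ 0# → ¬ ¬ x ≈ 0#
  x*x≈0⇒x≈0 xx≈0 x≉0 = x≉0 (x*y≈0⇒y≈0 x≉0 xx≈0)

  open import Algebra.Properties.Semiring.Sum semiring
    using ( sum; sum-syntax; sum-cong-≋; sum-remove; sum-replicate-zero; ∑-comm; ∑-permute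
          ; *-distribˡ-sum; *-distribʳ-sum)

  Σ≡sum : ∀ r (f : Fin r → Carrier) → Σ[_] K r f ≡ sum f
  Σ≡sum zero    f = ≡.refl
  Σ≡sum (suc r) f = ≡.cong (λ s → f zero + s) (Σ≡sum r (λ l → f (suc l)))

  sum-zero : ∀ {r} (f : Fin r → Carrier) → (∀ l → f l ≈ 0#) → sum f ≈ 0#
  sum-zero {r} f f≈0 = trans (sum-cong-≋ f≈0) (sum-replicate-zero r)

  sum-single : ∀ {r} (f : Fin (suc r) → Carrier) d → (∀ l → l ≢ d → f l ≈ 0#) → sum f ≈ f d
  sum-single f d f≈0 = begin
    sum f                      ≈⟨ sum-remove f ⟩
    f d + sum (removeAt f d)   ≈⟨ +-congˡ (sum-zero _ (λ l → f≈0 (punchIn d l) (punchInᵢ≢i d l))) ⟩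
    f d + 0#                   ≈⟨ +-identityʳ (f d) ⟩
    f d                        ∎

  -- Decompositions into simple tensors

  -- SumOfSimple with named fields, summed with the standard library's ∑ so that its lemmas apply.
  record Decomposition {n₁ n₂ n₃} (T : Tensor3 K n₁ n₂ n₃) (r : ℕ) : Set (c ⊔ ℓ) where
    field
      u : Fin r → Fin n₁ → Carrier
      v : Fin r → Fin n₂ → Carrier
      w : Fin r → Fin n₃ → Carrier
      sum-of-simple : ∀ i j k → T i j k ≈ ∑[ l < r ] (u l i * v l j * w l k)

  module _ {n₁ n₂ n₃} {T : Tensor3 K n₁ n₂ n₃} where

    fromSumOfSimple : ∀ {r} → SumOfSimple K T r → Decomposition T r
    fromSumOfSimple {r} (u , v , w , eq) =
      record { u = u ; v = v ; w = w ; sum-of-simple = λ i j k → trans (eq i j k) (reflexive (Σ≡sum r _)) }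

    toSumOfSimple : ∀ {r} → Decomposition T r → SumOfSimple K T r
    toSumOfSimple {r} D = u , v , w , λ i j k → trans (sum-of-simple i j k) (reflexive (≡.sym (Σ≡sum r _)))
      where open Decomposition D

    pad : ∀ {r} → Decomposition T r → Decomposition T (suc r)
    pad {r} D = record
      { u = λ { zero _ → 0# ; (suc l) → u l }
      ; v = λ { zero _ → 0# ; (suc l) → v l }
      ; w = λ { zero _ → 0# ; (suc l) → w l }
      ; sum-of-simple = λ i j k → begin
          T i j k                                  ≈⟨ sum-of-simple i j k ⟩
          ∑[ l < r ] (u l i * v l j * w l k)       ≈⟨ +-identityˡ _ ⟨
          0# + ∑[ l < r ] (u l i * v l j * w l k)  ≈⟨ +-congʳ (x≈0⇒x*y*z≈0 refl) ⟨
          0# * 0# * 0# + ∑[ l < r ] (u l i * v l j * w l k)  ∎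
      }
      where open Decomposition D

    pad-to : ∀ {s r} → s ≤′ r → Decomposition T s → Decomposition T r
    pad-to ≤′-refl        D = D
    pad-to (≤′-step s≤′r) D = pad (pad-to s≤′r D)

    rank-lower-bound : ∀ r → ¬ Decomposition T r → ∀ s → SumOfSimple K T s → suc r ≤ s
    rank-lower-bound r ¬D s D with s ℕ.≤? r
    ... | yes s≤r = ⊥-elim (¬D (pad-to (ℕ.≤⇒≤′ s≤r) (fromSumOfSimple D)))
    ... | no  s≰r = ℕ.≰⇒> s≰r

    remove-term : ∀ {r} (D : Decomposition T (suc r)) d → (∀ i → Decomposition.u D d i ≈ 0#) → Decomposition T r
    remove-term {r} D d u-d≈0 = record
      { u = removeAt u d
      ; v = removeAt v d
      ; w = removeAt w d
      ; sum-of-simple = λ i j k → let t = λ l → u l i * v l j * w l k in begin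
          T i j k                   ≈⟨ sum-of-simple i j k ⟩
          sum t                     ≈⟨ sum-remove {i = d} t ⟩
          t d + sum (removeAt t d)  ≈⟨ +-congʳ (x≈0⇒x*y*z≈0 (u-d≈0 i)) ⟩
          0# + sum (removeAt t d)   ≈⟨ +-identityˡ _ ⟩
          sum (removeAt t d)        ∎
      }
      where open Decomposition D

    permute-terms : ∀ {r} → Permutation r r → Decomposition T r → Decomposition T r
    permute-terms π D = record
      { u = λ l → u (π ⟨$⟩ʳ l)
      ; v = λ l → v (π ⟨$⟩ʳ l)
      ; w = λ l → w (π ⟨$⟩ʳ l)
      ; sum-of-simple = λ i j k → trans (sum-of-simple i j k) (∑-permute (λ l → u l i * v l j * w l k) π)
      }
      where open Decomposition D

    contract-first : ∀ {r} (D : Decomposition T r) (x : Fin n₁ → Carrier) j k →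
      let open Decomposition D in
      ∑[ i < n₁ ] (x i * T i j k) ≈ ∑[ l < r ] (∑[ i < n₁ ] (u l i * x i) * v l j * w l k)
    contract-first {r} D x j k = begin
      ∑[ i < n₁ ] (x i * T i j k)
        ≈⟨ sum-cong-≋ {n₁} (λ i → *-congˡ (sum-of-simple i j k)) ⟩
      ∑[ i < n₁ ] (x i * ∑[ l < r ] (u l i * v l j * w l k))
        ≈⟨ sum-cong-≋ {n₁} (λ i → *-distribˡ-sum (x i) (λ l → u l i * v l j * w l k)) ⟩
      ∑[ i < n₁ ] ∑[ l < r ] (x i * (u l i * v l j * w l k))
        ≈⟨ ∑-comm (λ i l → x i * (u l i * v l j * w l k)) ⟩
      ∑[ l < r ] ∑[ i < n₁ ] (x i * (u l i * v l j * w l k))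
        ≈⟨ sum-cong-≋ {r} (λ l → sum-cong-≋ {n₁} (λ i → regroup (x i) (u l i) (v l j) (w l k))) ⟩
      ∑[ l < r ] ∑[ i < n₁ ] (u l i * x i * (v l j * w l k))
        ≈⟨ sum-cong-≋ {r} (λ l → *-distribʳ-sum (v l j * w l k) (λ i → u l i * x i)) ⟨
      ∑[ l < r ] (∑[ i < n₁ ] (u l i * x i) * (v l j * w l k))
        ≈⟨ sum-cong-≋ {r} (λ l → *-assoc _ _ _) ⟨
      ∑[ l < r ] (∑[ i < n₁ ] (u l i * x i) * v l j * w l k)
        ∎
      where
      open Decomposition D
      regroup : ∀ x a b c → x * (a * b * c) ≈ a * x * (b * c)
      regroup = solve 4 (λ x a b c → x :* (a :* b :* c) := a :* x :* (b :* c)) refl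

  module _ {n m} {T : Tensor3 K n m n} where

    swap-first-third : ∀ {r} → (∀ i j k → T k j i ≈ T i j k) → Decomposition T r → Decomposition T r
    swap-first-third {r} T-sym D = record
      { u = w
      ; v = v
      ; w = u
      ; sum-of-simple = λ i j k → begin
          T i j k                              ≈⟨ T-sym i j k ⟨
          T k j i                              ≈⟨ sum-of-simple k j i ⟩
          ∑[ l < r ] (u l k * v l j * w l i)   ≈⟨ sum-cong-≋ {r} (λ l → reverse (u l k) (v l j) (w l i)) ⟩
          ∑[ l < r ] (w l i * v l j * u l k)   ∎
      }
      where
      open Decomposition D
      reverse : ∀ a b c → a * b * c ≈ c * b * a
      reverse = solve 3 (λ a b c → a :* b :* c := c :* b :* a) refl

  contract-matrix : ∀ {r m n} {M : Fin m → Fin n → Carrier} (a : Fin r → Fin m → Carrier)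
    (b : Fin r → Fin n → Carrier) → (∀ j k → M j k ≈ ∑[ l < r ] (a l j * b l k)) →
    ∀ (z : Fin n → Carrier) j → ∑[ k < n ] (M j k * z k) ≈ ∑[ l < r ] (a l j * ∑[ k < n ] (b l k * z k))
  contract-matrix {r} {m} {n} {M} a b M≈∑ab z j = begin
    ∑[ k < n ] (M j k * z k)
      ≈⟨ sum-cong-≋ {n} (λ k → *-congʳ (M≈∑ab j k)) ⟩
    ∑[ k < n ] (∑[ l < r ] (a l j * b l k) * z k)
      ≈⟨ sum-cong-≋ {n} (λ k → *-distribʳ-sum (z k) (λ l → a l j * b l k)) ⟩
    ∑[ k < n ] ∑[ l < r ] (a l j * b l k * z k)
      ≈⟨ ∑-comm (λ k l → a l j * b l k * z k) ⟩
    ∑[ l < r ] ∑[ k < n ] (a l j * b l k * z k)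
      ≈⟨ sum-cong-≋ {r} (λ l → sum-cong-≋ {n} (λ k → *-assoc _ _ _)) ⟩
    ∑[ l < r ] ∑[ k < n ] (a l j * (b l k * z k))
      ≈⟨ sum-cong-≋ {r} (λ l → *-distribˡ-sum (a l j) (λ k → b l k * z k)) ⟨
    ∑[ l < r ] (a l j * ∑[ k < n ] (b l k * z k))
      ∎

  rank-one-minor : ∀ {m n} {M : Fin m → Fin n → Carrier} (p : Fin m → Carrier) (q : Fin n → Carrier) →
    (∀ j k → M j k ≈ p j * q k) → ∀ j j′ k k′ → M j k * M j′ k′ ≈ M j k′ * M j′ k
  rank-one-minor {M = M} p q M≈pq j j′ k k′ = begin
    M j k * M j′ k′            ≈⟨ *-cong (M≈pq j k) (M≈pq j′ k′) ⟩
    p j * q k * (p j′ * q k′)  ≈⟨ exchange (p j) (q k) (p j′) (q k′) ⟩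
    p j * q k′ * (p j′ * q k)  ≈⟨ *-cong (M≈pq j k′) (M≈pq j′ k) ⟨
    M j k′ * M j′ k            ∎
    where
    exchange : ∀ a b c d → a * b * (c * d) ≈ a * d * (c * b)
    exchange = solve 4 (λ a b c d → a :* b :* (c :* d) := a :* d :* (c :* b)) refl

  -- Vector algebra in K³

  open Vector3 rawRing

  K³ : Set c
  K³ = Fin 3 → Carrier

  IsZero : K³ → Set ℓ
  IsZero x = ∀ i → x i ≈ 0#

  _∥_ : K³ → K³ → Set ℓ
  x ∥ y = IsZero (cross x y)

  basis : Fin 3 → K³
  basis i j = ι (δ i j)

  polynomials : ℕ → RawRing _ _
  polynomials n = record
    { Carrier = Polynomial n ; _≈_ = _≡_
    ; _+_ = _:+_ ; _*_ = _:*_ ; -_ = :-_ ; 0# = con (+ 0) ; 1# = con (+ 1)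
    }

  module Symbolic {n} = Vector3 (polynomials n)

  symbolic : ∀ {k} → Fin k → Fin 3 → Polynomial (k ℕ.* 3)
  symbolic m i = var (combine m i)

  components : ∀ {k} → Vec K³ k → Vec Carrier (k ℕ.* 3)
  components []       = []
  components (x ∷ xs) = x 0F ∷ x 1F ∷ x 2F ∷ components xs

  prove′ : ∀ {n} (ρ : Vec Carrier n) (e : Polynomial n × Polynomial n) →
    ⟦ proj₁ e ⟧↓ ρ ≈ ⟦ proj₂ e ⟧↓ ρ → ⟦ proj₁ e ⟧ ρ ≈ ⟦ proj₂ e ⟧ ρ
  prove′ ρ (lhs , rhs) = prove ρ lhs rhs

  module _ (a b : K³) where
    private
      ρ = components (a ∷ b ∷ [])
      𝕒 = symbolic {2} 0F
      𝕓 = symbolic {2} 1F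
      antisym : Fin 3 → Polynomial 6 × Polynomial 6
      antisym i = Symbolic.cross 𝕒 𝕓 i := :- Symbolic.cross 𝕓 𝕒 i

    cross-orthogonalˡ : dot a (cross a b) ≈ 0#
    cross-orthogonalˡ = prove ρ (Symbolic.dot 𝕒 (Symbolic.cross 𝕒 𝕓)) (con (+ 0)) refl

    cross-orthogonalʳ : dot b (cross a b) ≈ 0#
    cross-orthogonalʳ = prove ρ (Symbolic.dot 𝕓 (Symbolic.cross 𝕒 𝕓)) (con (+ 0)) refl

    cross-antisym : ∀ i → cross a b i ≈ - cross b a i
    cross-antisym 0F = prove′ ρ (antisym 0F) refl
    cross-antisym 1F = prove′ ρ (antisym 1F) refl
    cross-antisym 2F = prove′ ρ (antisym 2F) refl

  module _ (a b c : K³) where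
    private
      ρ = components (a ∷ b ∷ c ∷ [])
      𝕒 = symbolic {3} 0F
      𝕓 = symbolic {3} 1F
      𝕔 = symbolic {3} 2F
      bac-cab : Fin 3 → Polynomial 9 × Polynomial 9
      bac-cab i = Symbolic.cross 𝕒 (Symbolic.cross 𝕓 𝕔) i := Symbolic.dot 𝕒 𝕔 :* 𝕓 i :+ :- (Symbolic.dot 𝕒 𝕓 :* 𝕔 i)

    dot-cross-rotate : dot a (cross b c) ≈ dot c (cross a b)
    dot-cross-rotate = prove ρ (Symbolic.dot 𝕒 (Symbolic.cross 𝕓 𝕔)) (Symbolic.dot 𝕔 (Symbolic.cross 𝕒 𝕓)) refl

    cross-cross : ∀ i → cross a (cross b c) i ≈ dot a c * b i + - (dot a b * c i)
    cross-cross 0F = prove′ ρ (bac-cab 0F) refl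
    cross-cross 1F = prove′ ρ (bac-cab 1F) refl
    cross-cross 2F = prove′ ρ (bac-cab 2F) refl

  module _ (a b c p : K³) where
    private
      ρ = components (a ∷ b ∷ c ∷ p ∷ [])
      𝕒 = symbolic {4} 0F
      𝕓 = symbolic {4} 1F
      𝕔 = symbolic {4} 2F
      𝕡 = symbolic {4} 3F
      cramer : Fin 3 → Polynomial 12 × Polynomial 12
      cramer i = Symbolic.dot 𝕒 (Symbolic.cross 𝕓 𝕔) :* 𝕡 i
        := Symbolic.dot 𝕡 (Symbolic.cross 𝕓 𝕔) :* 𝕒 i
           :+ :- (Symbolic.dot 𝕡 (Symbolic.cross 𝕒 𝕔) :* 𝕓 i)
           :+ Symbolic.dot 𝕡 (Symbolic.cross 𝕒 𝕓) :* 𝕔 i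

    cramer-rule : ∀ i → dot a (cross b c) * p i ≈
      dot p (cross b c) * a i + - (dot p (cross a c) * b i) + dot p (cross a b) * c i
    cramer-rule 0F = prove′ ρ (cramer 0F) refl
    cramer-rule 1F = prove′ ρ (cramer 1F) refl
    cramer-rule 2F = prove′ ρ (cramer 2F) refl

  dot-zeroʳ : ∀ x {y} → IsZero y → dot x y ≈ 0#
  dot-zeroʳ x y≈0 = sum-zero (λ i → x i * _) (λ i → trans (*-congˡ (y≈0 i)) (zeroʳ (x i)))

  cross-self : ∀ a → a ∥ a
  cross-self a 0F = commutator-zero
  cross-self a 1F = commutator-zero
  cross-self a 2F = commutator-zero

  ∥-sym : ∀ {a b} → a ∥ b → b ∥ a
  ∥-sym {a} {b} a∥b i = trans (cross-antisym b a i) (trans (-‿cong (a∥b i)) -0#≈0#)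

  cross-zeroʳ : ∀ p {y} → IsZero y → IsZero (cross p y)
  cross-zeroʳ p {y} y≈0 = ∥-sym zero∥p
    where
    vanishes : ∀ {j k} → y j ≈ 0# → y k ≈ 0# → y j * p k + - (y k * p j) ≈ 0#
    vanishes yj≈0 yk≈0 = trans (+-cong (x≈0⇒x*y≈0 yj≈0) (-‿cong (x≈0⇒x*y≈0 yk≈0))) (trans (+-identityˡ _) -0#≈0#)
    zero∥p : y ∥ p
    zero∥p 0F = vanishes (y≈0 1F) (y≈0 2F)
    zero∥p 1F = vanishes (y≈0 2F) (y≈0 0F)
    zero∥p 2F = vanishes (y≈0 0F) (y≈0 1F)

  ∥⇒triple-product-zero : ∀ {a b} c → a ∥ b → dot a (cross b c) ≈ 0#
  ∥⇒triple-product-zero {a} {b} c a∥b = trans (dot-cross-rotate a b c) (dot-zeroʳ c a∥b)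

  module _ (p : K³) where
    private
      ρ = components (p ∷ [])
      𝕡 = symbolic {1} 0F
      𝕖 : Fin 3 → Fin 3 → Polynomial 3
      𝕖 i j = con (δ i j)

    cross-basis-zero : (∀ i → IsZero (cross p (basis i))) → IsZero p
    cross-basis-zero p×e≈0 0F = trans (prove ρ (𝕡 0F) (Symbolic.cross 𝕡 (𝕖 1F) 2F) refl) (p×e≈0 1F 2F)
    cross-basis-zero p×e≈0 1F = trans (prove ρ (𝕡 1F) (Symbolic.cross 𝕡 (𝕖 2F) 0F) refl) (p×e≈0 2F 0F)
    cross-basis-zero p×e≈0 2F = trans (prove ρ (𝕡 2F) (Symbolic.cross 𝕡 (𝕖 0F) 1F) refl) (p×e≈0 0F 1F)

  cramer-zero : ∀ a b c {p} → ¬ dot a (cross b c) ≈ 0# →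
    dot p (cross b c) ≈ 0# → dot p (cross a c) ≈ 0# → dot p (cross a b) ≈ 0# → IsZero p
  cramer-zero a b c {p} det≉0 ⊥bc ⊥ac ⊥ab i = x*y≈0⇒y≈0 det≉0 (begin
    dot a (cross b c) * p i
      ≈⟨ cramer-rule a b c p i ⟩
    dot p (cross b c) * a i + - (dot p (cross a c) * b i) + dot p (cross a b) * c i
      ≈⟨ +-cong (+-cong (x≈0⇒x*y≈0 ⊥bc) (-‿cong (x≈0⇒x*y≈0 ⊥ac))) (x≈0⇒x*y≈0 ⊥ab) ⟩
    0# + - 0# + 0#
      ≈⟨ trans (+-identityʳ _) (trans (+-identityˡ _) -0#≈0#) ⟩
    0#
      ∎)

  parallel-orthogonal⇒zero : ∀ p {x z} → x ∥ z → dot p x ≈ 0# → ¬ dot p z ≈ 0# → IsZero x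
  parallel-orthogonal⇒zero p {x} {z} x∥z p⊥x p⊥̸z i = x*y≈0⇒y≈0 p⊥̸z (begin
    dot p z * x i                                    ≈⟨ +-identityʳ _ ⟨
    dot p z * x i + 0#                               ≈⟨ +-congˡ (trans (-‿cong (x≈0⇒x*y≈0 p⊥x)) -0#≈0#) ⟨
    dot p z * x i + - (dot p x * z i)                ≈⟨ cross-cross p x z i ⟨
    cross p (cross x z) i                            ≈⟨ cross-zeroʳ p x∥z i ⟩
    0#                                               ∎)

  -- Slices of per₃ and the lower bound 4

  per₃ : Tensor3 K 3 3 3
  per₃ = castTensor K per3

  per₃-symmetric₁₃ : ∀ i j k → per₃ k j i ≈ per₃ i j k
  per₃-symmetric₁₃ i j k = reflexive (≡.cong ι (per3-symmetric₁₃ i j k))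

  module _ (x : K³) where
    private
      ρ = components (x ∷ [])
      𝕩 = symbolic {1} 0F
      slice : Fin 3 → Fin 3 → Polynomial 3 × Polynomial 3
      slice j k = Symbolic.dot 𝕩 (λ i → con (per3 i j k)) := Symbolic.permanentSlice 𝕩 j k

    contract-per₃ : ∀ j k → ∑[ i < 3 ] (x i * per₃ i j k) ≈ permanentSlice x j k
    contract-per₃ 0F 0F = prove′ ρ (slice 0F 0F) refl
    contract-per₃ 0F 1F = prove′ ρ (slice 0F 1F) refl
    contract-per₃ 0F 2F = prove′ ρ (slice 0F 2F) refl
    contract-per₃ 1F 0F = prove′ ρ (slice 1F 0F) refl
    contract-per₃ 1F 1F = prove′ ρ (slice 1F 1F) refl
    contract-per₃ 1F 2F = prove′ ρ (slice 1F 2F) refl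
    contract-per₃ 2F 0F = prove′ ρ (slice 2F 0F) refl
    contract-per₃ 2F 1F = prove′ ρ (slice 2F 1F) refl
    contract-per₃ 2F 2F = prove′ ρ (slice 2F 2F) refl

  rank-one-slice⇒zero : ∀ x (p q : K³) → (∀ j k → permanentSlice x j k ≈ p j * q k) → ¬ ¬ IsZero x
  rank-one-slice⇒zero x p q slice≈pq = do
      x₀≈0 ← x*x≈0⇒x≈0 (trans (vanishing-minor 1F 2F) (zeroˡ 0#))
      x₁≈0 ← x*x≈0⇒x≈0 (trans (vanishing-minor 0F 2F) (zeroˡ 0#))
      x₂≈0 ← x*x≈0⇒x≈0 (trans (vanishing-minor 0F 1F) (zeroˡ 0#))
      pure λ { 0F → x₀≈0 ; 1F → x₁≈0 ; 2F → x₂≈0 }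
    where
    vanishing-minor : ∀ j k → permanentSlice x j k * permanentSlice x k j ≈ permanentSlice x j j * permanentSlice x k k
    vanishing-minor j k = rank-one-minor p q slice≈pq j k k j

  module _ {r} (D : Decomposition per₃ r) where
    open Decomposition D

    slice-decomposition : ∀ x j k → permanentSlice x j k ≈ ∑[ l < r ] (dot (u l) x * v l j * w l k)
    slice-decomposition x j k = trans (sym (contract-per₃ x j k)) (contract-first D x j k)

  module _ {r} (D : Decomposition per₃ (suc r)) where
    open Decomposition D

    isolated-slice⇒zero : ∀ d x → (∀ l → l ≢ d → dot (u l) x ≈ 0#) → ¬ ¬ IsZero x
    isolated-slice⇒zero d x x⊥u = rank-one-slice⇒zero x (λ j → dot (u d) x * v d j) (w d) λ j k →
      trans (slice-decomposition D x j k)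
            (sum-single (λ l → dot (u l) x * v l j * w l k) d (λ l l≢d → x≈0⇒x*y*z≈0 (x⊥u l l≢d)))

    all-but-one-parallel⇒zero : ∀ d p → (∀ l → l ≢ d → u l ∥ p) → ¬ ¬ IsZero p
    all-but-one-parallel⇒zero d p u∥p = do
        p×e₀≈0 ← isolated-slice⇒zero d (cross p (basis 0F)) (orthogonal 0F)
        p×e₁≈0 ← isolated-slice⇒zero d (cross p (basis 1F)) (orthogonal 1F)
        p×e₂≈0 ← isolated-slice⇒zero d (cross p (basis 2F)) (orthogonal 2F)
        pure (cross-basis-zero p λ { 0F → p×e₀≈0 ; 1F → p×e₁≈0 ; 2F → p×e₂≈0 })
      where
      orthogonal : ∀ i l → l ≢ d → dot (u l) (cross p (basis i)) ≈ 0#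
      orthogonal i l l≢d = ∥⇒triple-product-zero (basis i) (u∥p l l≢d)

    first-factors-not-all-zero : ¬ (∀ l → IsZero (u l))
    first-factors-not-all-zero u≈0 = 1≉0 (begin
      1#                                         ≈⟨ +-identityʳ 1# ⟨
      per₃ 0F 1F 2F                              ≈⟨ sum-of-simple 0F 1F 2F ⟩
      ∑[ l < suc r ] (u l 0F * v l 1F * w l 2F)  ≈⟨ sum-zero (λ l → u l 0F * v l 1F * w l 2F) term≈0 ⟩
      0#                                         ∎)
      where
      term≈0 : ∀ l → u l 0F * v l 1F * w l 2F ≈ 0#
      term≈0 l = x≈0⇒x*y*z≈0 (u≈0 l 0F)

  no-rank-three : ¬ Decomposition per₃ 3
  no-rank-three D = ¬¬⊥⇒⊥ do
      u₁∥u₂ ← isolated-slice⇒zero D 0F (cross (u 1F) (u 2F)) λ where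
        0F 0≢0 → contradiction ≡.refl 0≢0
        1F _   → cross-orthogonalˡ (u 1F) (u 2F)
        2F _   → cross-orthogonalʳ (u 1F) (u 2F)
      u₀∥u₂ ← isolated-slice⇒zero D 1F (cross (u 0F) (u 2F)) λ where
        0F _   → cross-orthogonalˡ (u 0F) (u 2F)
        1F 1≢1 → contradiction ≡.refl 1≢1
        2F _   → cross-orthogonalʳ (u 0F) (u 2F)
      u₀∥u₁ ← isolated-slice⇒zero D 2F (cross (u 0F) (u 1F)) λ where
        0F _   → cross-orthogonalˡ (u 0F) (u 1F)
        1F _   → cross-orthogonalʳ (u 0F) (u 1F)
        2F 2≢2 → contradiction ≡.refl 2≢2
      u₀≈0 ← all-but-one-parallel⇒zero D 0F (u 0F) λ where
        0F 0≢0 → contradiction ≡.refl 0≢0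
        1F _   → ∥-sym u₀∥u₁
        2F _   → ∥-sym u₀∥u₂
      u₁≈0 ← all-but-one-parallel⇒zero D 1F (u 1F) λ where
        0F _   → u₀∥u₁
        1F 1≢1 → contradiction ≡.refl 1≢1
        2F _   → ∥-sym u₁∥u₂
      u₂≈0 ← all-but-one-parallel⇒zero D 2F (u 2F) λ where
        0F _   → u₀∥u₂
        1F _   → u₁∥u₂
        2F 2≢2 → contradiction ≡.refl 2≢2
      pure (first-factors-not-all-zero D λ { 0F → u₀≈0 ; 1F → u₁≈0 ; 2F → u₂≈0 })
    where open Decomposition D

  no-parallel-first-factors : (D : Decomposition per₃ 4) → Decomposition.u D 0F ∥ Decomposition.u D 1F → ⊥
  no-parallel-first-factors D u₀∥u₁ = ¬¬⊥⇒⊥ do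
      u₁∥u₃ ← isolated-slice⇒zero D 2F (cross (u 1F) (u 3F)) λ where
        0F _   → ∥⇒triple-product-zero (u 3F) u₀∥u₁
        1F _   → cross-orthogonalˡ (u 1F) (u 3F)
        2F 2≢2 → contradiction ≡.refl 2≢2
        3F _   → cross-orthogonalʳ (u 1F) (u 3F)
      u₁∥u₂ ← isolated-slice⇒zero D 3F (cross (u 1F) (u 2F)) λ where
        0F _   → ∥⇒triple-product-zero (u 2F) u₀∥u₁
        1F _   → cross-orthogonalˡ (u 1F) (u 2F)
        2F _   → cross-orthogonalʳ (u 1F) (u 2F)
        3F 3≢3 → contradiction ≡.refl 3≢3
      u₂∥u₃ ← isolated-slice⇒zero D 0F (cross (u 2F) (u 3F)) λ where
        0F 0≢0 → contradiction ≡.refl 0≢0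
        1F _   → ∥⇒triple-product-zero (u 3F) u₁∥u₂
        2F _   → cross-orthogonalˡ (u 2F) (u 3F)
        3F _   → cross-orthogonalʳ (u 2F) (u 3F)
      u₃≈0 ← all-but-one-parallel⇒zero D 0F (u 3F) λ where
        0F 0≢0 → contradiction ≡.refl 0≢0
        1F _   → u₁∥u₃
        2F _   → u₂∥u₃
        3F _   → cross-self (u 3F)
      pure (no-rank-three (remove-term D 3F u₃≈0))
    where open Decomposition D

  -- Characteristic 2: the lower bound 5

  module Characteristic2 (2≈0 : natCast K 2 ≈ 0#) where

    module _ (x z : K³) where
      private
        ρ = components (x ∷ z ∷ [])
        𝕩 = symbolic {2} 0F
        𝕫 = symbolic {2} 1F
        defect : Fin 3 → Polynomial 6
        defect 0F = 𝕩 2F :* 𝕫 1F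
        defect 1F = 𝕩 0F :* 𝕫 2F
        defect 2F = 𝕩 1F :* 𝕫 0F
        action : Fin 3 → Polynomial 6 × Polynomial 6
        action j = Symbolic.dot (Symbolic.permanentSlice 𝕩 j) 𝕫 := Symbolic.cross 𝕩 𝕫 j :+ con (+ 2) :* defect j
        even≈0 : ∀ {a b} → a + natCast K 2 * b ≈ a
        even≈0 = trans (+-congˡ (x≈0⇒x*y≈0 2≈0)) (+-identityʳ _)

      -- The slice matrix and the matrix of x × – differ only in signs, so by an even amount.
      slice-acts-as-cross : ∀ j → dot (permanentSlice x j) z ≈ cross x z j
      slice-acts-as-cross 0F = trans (prove′ ρ (action 0F) refl) even≈0
      slice-acts-as-cross 1F = trans (prove′ ρ (action 1F) refl) even≈0
      slice-acts-as-cross 2F = trans (prove′ ρ (action 2F) refl) even≈0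

    module _ (D : Decomposition per₃ 4) where
      open Decomposition D

      -- Contracting with x = u₂ × u₃ in the first factor and z = w₀ × w₁ in the third kills
      -- every term, so x ∥ z; then u₃ · z ≉ 0 would make u₂ ∥ u₃.
      fourth-factor-orthogonal : ¬ ¬ (dot (u 3F) (cross (w 0F) (w 1F)) ≈ 0#)
      fourth-factor-orthogonal = ¬¬-excluded-middle >>= λ where
          (yes u₃⊥z) → pure u₃⊥z
          (no u₃⊥̸z) → ⊥-elim (no-parallel-first-factors (permute-terms (transpose 0F 2F ∘ₚ transpose 1F 3F) D)
            (parallel-orthogonal⇒zero (u 3F) x∥z (cross-orthogonalʳ (u 2F) (u 3F)) u₃⊥̸z))
        where
        x = cross (u 2F) (u 3F)
        z = cross (w 0F) (w 1F)
        x∥z : x ∥ z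
        x∥z j = begin
          cross x z j
            ≈⟨ slice-acts-as-cross x z j ⟨
          dot (permanentSlice x j) z
            ≈⟨ contract-matrix (λ l j → dot (u l) x * v l j) w (slice-decomposition D x) z j ⟩
          ∑[ l < 4 ] (dot (u l) x * v l j * dot (w l) z)
            ≈⟨ sum-zero (λ l → dot (u l) x * v l j * dot (w l) z) (λ where
            0F → x≈0⇒y*x≈0 (cross-orthogonalˡ (w 0F) (w 1F))
            1F → x≈0⇒y*x≈0 (cross-orthogonalʳ (w 0F) (w 1F))
            2F → x≈0⇒x*y*z≈0 (cross-orthogonalˡ (u 2F) (u 3F))
            3F → x≈0⇒x*y*z≈0 (cross-orthogonalʳ (u 2F) (u 3F))) ⟩
          0#
            ∎

    no-rank-four : ¬ Decomposition per₃ 4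
    no-rank-four D = ¬¬⊥⇒⊥ (¬¬-excluded-middle >>= by-cases)
      where
      open Decomposition D
      by-cases : Dec (dot (w 0F) (cross (w 1F) (w 2F)) ≈ 0#) → ¬ ¬ ⊥
      by-cases (yes det≈0) = do
          w₀∥w₁ ← isolated-slice⇒zero D′ 3F (cross (w 0F) (w 1F)) λ where
            0F _   → cross-orthogonalˡ (w 0F) (w 1F)
            1F _   → cross-orthogonalʳ (w 0F) (w 1F)
            2F _   → trans (sym (dot-cross-rotate (w 0F) (w 1F) (w 2F))) det≈0
            3F 3≢3 → contradiction ≡.refl 3≢3
          pure (no-parallel-first-factors D′ w₀∥w₁)
        where D′ = swap-first-third per₃-symmetric₁₃ D
      by-cases (no det≉0) = do
          u₃⊥w₀×w₁ ← fourth-factor-orthogonal D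
          u₃⊥w₀×w₂ ← fourth-factor-orthogonal (permute-terms (transpose 1F 2F) D)
          u₃⊥w₁×w₂ ← fourth-factor-orthogonal (permute-terms (transpose 0F 1F ∘ₚ transpose 0F 2F) D)
          let u₃≈0 = cramer-zero (w 0F) (w 1F) (w 2F) det≉0 u₃⊥w₁×w₂ u₃⊥w₀×w₂ u₃⊥w₀×w₁
          pure (no-rank-three (remove-term D 3F u₃≈0))

  -- Upper bounds

  intCast-sum : ∀ {r} (f : Fin r → ℤ) → ι (sumℤ f) ≈ ∑[ l < r ] ι (f l)
  intCast-sum {zero}  f = refl
  intCast-sum {suc r} f = trans (intCast-+ (f 0F) _) (+-congˡ (intCast-sum (λ l → f (suc l))))

  integer-decomposition : ∀ {n₁ n₂ n₃ r} (T : Fin n₁ → Fin n₂ → Fin n₃ → ℤ) m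
    (x : Fin r → Fin n₁ → ℤ) (y : Fin r → Fin n₂ → ℤ) (z : Fin r → Fin n₃ → ℤ) →
    (∀ i j k → sumℤ (λ l → x l i ℤ.* y l j ℤ.* z l k) ≡ m ℤ.* T i j k) →
    ∀ m⁻¹ → ι m * m⁻¹ ≈ 1# → Decomposition (castTensor K T) r
  integer-decomposition {r = r} T m x y z Σxyz≡mT m⁻¹ mm⁻¹≈1 = record
    { u = λ l i → ι (x l i)
    ; v = λ l j → ι (y l j)
    ; w = λ l k → ι (z l k) * m⁻¹
    ; sum-of-simple = λ i j k → let xyz = λ l → x l i ℤ.* y l j ℤ.* z l k in begin
        ι (T i j k)                                             ≈⟨ *-identityʳ _ ⟨
        ι (T i j k) * 1#                                        ≈⟨ *-congˡ mm⁻¹≈1 ⟨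
        ι (T i j k) * (ι m * m⁻¹)                               ≈⟨ exchange (ι (T i j k)) (ι m) m⁻¹ ⟩
        ι m * ι (T i j k) * m⁻¹                                 ≈⟨ *-congʳ (intCast-* m (T i j k)) ⟨
        ι (m ℤ.* T i j k) * m⁻¹                                 ≡⟨ ≡.cong (λ t → ι t * m⁻¹) (Σxyz≡mT i j k) ⟨
        ι (sumℤ xyz) * m⁻¹                                      ≈⟨ *-congʳ (intCast-sum xyz) ⟩
        ∑[ l < r ] ι (xyz l) * m⁻¹                              ≈⟨ *-distribʳ-sum m⁻¹ (λ l → ι (xyz l)) ⟩
        ∑[ l < r ] (ι (xyz l) * m⁻¹)                            ≈⟨ sum-cong-≋ {r} (λ l → split (x l i) (y l j) (z l k)) ⟩
        ∑[ l < r ] (ι (x l i) * ι (y l j) * (ι (z l k) * m⁻¹))  ∎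
    }
    where
    exchange : ∀ t a b → t * (a * b) ≈ a * t * b
    exchange = solve 3 (λ t a b → t :* (a :* b) := a :* t :* b) refl
    split : ∀ a b c → ι (a ℤ.* b ℤ.* c) * m⁻¹ ≈ ι a * ι b * (ι c * m⁻¹)
    split a b c = trans (*-congʳ (trans (intCast-* (a ℤ.* b) c) (*-congʳ (intCast-* a b)))) (*-assoc _ _ _)

  per₃-decomposition₅ : Decomposition per₃ 5
  per₃-decomposition₅ =
    integer-decomposition per3 1ℤ five₁ five₂ five₃ five-term-formula 1# (trans (*-identityʳ _) (+-identityʳ 1#))

  per₃-decomposition₄ : ¬ natCast K 2 ≈ 0# → Decomposition per₃ 4
  per₃-decomposition₄ 2≉0 with inverse (natCast K 2) 2≉0
  ... | ½ , 2*½≈1 = integer-decomposition per3 (+ 4) glynn glynn glynn-signed glynn-formula (½ * ½) (begin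
    ι (+ 4) * (½ * ½)                ≈⟨ *-congʳ (intCast-* (+ 2) (+ 2)) ⟩
    ι (+ 2) * ι (+ 2) * (½ * ½)      ≈⟨ solve 2 (λ t h → t :* t :* (h :* h) := t :* h :* (t :* h)) refl _ ½ ⟩
    ι (+ 2) * ½ * (ι (+ 2) * ½)      ≈⟨ *-cong 2*½≈1 2*½≈1 ⟩
    1# * 1#                          ≈⟨ *-identityʳ 1# ⟩
    1#                               ∎)

  tensorRank-per₃ : ¬ natCast K 2 ≈ 0# → TensorRank K per₃ 4
  tensorRank-per₃ 2≉0 = toSumOfSimple (per₃-decomposition₄ 2≉0) , rank-lower-bound 3 no-rank-three

  tensorRank-per₃-char2 : natCast K 2 ≈ 0# → TensorRank K per₃ 5
  tensorRank-per₃-char2 2≈0 = toSumOfSimple per₃-decomposition₅ , rank-lower-bound 4 (Characteristic2.no-rank-four 2≈0)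

∣2⇒≡2 : ∀ p → p ≡ 0 ⊎ Prime p → p ∣ 2 → p ≡ 2
∣2⇒≡2 p (inj₁ ≡.refl) 0∣2 = contradiction (0∣⇒≡0 0∣2) λ ()
∣2⇒≡2 p (inj₂ p-prime) p∣2 = ℕ.≤-antisym (∣⇒≤ p∣2) (ℕ.nonTrivial⇒n>1 p {{prime⇒nonTrivial p-prime}})

-- The rank is computed over an arbitrary field.
corollary6p5 : ∀ {c ℓ} (K : Field c ℓ) → AlgebraicallyClosed K → (p : ℕ) → (p ≡ 0 ⊎ Prime p) → HasCharacteristic K p
                   → (p ≡ 2 → TensorRank K (castTensor K per3) 5) × (p ≢ 2 → TensorRank K (castTensor K per3) 4)
corollary6p5 K _ p p-prime char-p =
  (λ p≡2 → tensorRank-per₃-char2 (two≈0 p≡2)) , (λ p≢2 → tensorRank-per₃ (two≉0 p≢2))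
  where
  open PermanentTensor K
  open Field K using (_≈_; 0#)
  two≈0 : p ≡ 2 → natCast K 2 ≈ 0#
  two≈0 ≡.refl = Equivalence.from (char-p 2) ∣-refl
  two≉0 : p ≢ 2 → ¬ natCast K 2 ≈ 0#
  two≉0 p≢2 2≈0 = p≢2 (∣2⇒≡2 p p-prime (Equivalence.to (char-p 2) 2≈0))
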